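{- Let $n\ge1$. The interval $[\,12\cdots n12\cdots n,\ 12\cdots nn\cdots21\,]$ in the combinatorial barcode lattice $\mathbf{BL}(2^n)$ has exactly $n!$ elements.
   Context: $\mathbf{BL}(2^n)$ is the set of words containing each of $1,\dots,n$ exactly twice in which the first occurrence of $i$ precedes the first occurrence of $i+1$ for each $i\in[n-1]$, partially ordered by the reflexive-transitive closure of: $s\lessdot t$ iff $t$ arises from $s$ by swapping two adjacent entries $a<b$ appearing as $ab$ in $s$. -}

module Defs where

open import Data.Nat using (ℕ; zero; suc; _≤_; _<_; _≟_; _!)
open import Data.List using (List; []; _∷_; _++_; applyUpTo; reverse; length)
open import Data.List.Membership.Propositional using (_∈_)
open import Data.List.Relation.Unary.Unique.Propositional using (Unique)
open import Data.Product using (Σ; ∃; _×_)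
open import Relation.Nullary using (yes; no)
open import Relation.Binary.PropositionalEquality using (_≡_)
open import Relation.Binary.Construct.Closure.ReflexiveTransitive using (Star)

Word : Set
Word = List ℕ

count : ℕ → Word → ℕ
count x [] = zero
count x (y ∷ w) with x ≟ y
... | yes _ = suc (count x w)
... | no  _ = count x w

-- w ∈ BL(2^n): letters from [n], each i ∈ [n] exactly twice, and for
-- i ∈ [n-1] the first occurrence of i precedes the first occurrence of i+1
-- (i.e. every prefix ending just before an occurrence of i+1 contains i).
IsBL : ℕ → Word → Set
IsBL n w =
  (∀ x → x ∈ w → (1 ≤ x × x ≤ n)) ×
  (∀ i → 1 ≤ i → i ≤ n → count i w ≡ 2) ×
  (∀ i → 1 ≤ i → i < n → ∀ u v → w ≡ u ++ (suc i ∷ v) → i ∈ u)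

Swap : Word → Word → Set
Swap s t = Σ Word λ u → Σ Word λ v → Σ ℕ λ a → Σ ℕ λ b →
  (a < b) × (s ≡ u ++ (a ∷ b ∷ v)) × (t ≡ u ++ (b ∷ a ∷ v))

Cover : ℕ → Word → Word → Set
Cover n s t = IsBL n s × IsBL n t × Swap s t

_≤BL[_]_ : Word → ℕ → Word → Set
s ≤BL[ n ] t = Star (Cover n) s t

incr : ℕ → Word
incr n = applyUpTo suc n

bottomWord : ℕ → Word
bottomWord n = incr n ++ incr n

topWord : ℕ → Word
topWord n = incr n ++ reverse (incr n)

InInterval : ℕ → Word → Word → Word → Set
InInterval n s t w = IsBL n w × (s ≤BL[ n ] w) × (w ≤BL[ n ] t)

-- Every word of the interval has the form 12⋯n σ with σ a permutation of 12⋯n.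
-- The interval is closed under the prefix 12⋯n: an ascending swap across the
-- boundary would need a letter larger than n, and one inside the prefix puts
-- i+1 before the first i.  Conversely, for such σ the word 12⋯n σ is in
-- BL(2^n), since the prefix already fixes all first occurrences, and bubble
-- sort connects 12⋯n to σ and σ to n⋯21 by ascending adjacent swaps.
module Submission where

open import Defs
open import Data.Nat using (ℕ; zero; suc; _+_; _*_; _≤_; _<_; _≟_; _!; _≤?_; z≤n; s≤s)
open import Data.Nat.Properties using (+-commutativeSemigroup; +-comm; *-comm; suc-injective; <⇒≢; <⇒≤; <-≤-trans; ≤-reflexive; ≤⇒≯)
open import Algebra.Properties.CommutativeSemigroup +-commutativeSemigroup using (x∙yz≈y∙xz)
open import Data.List using (List; []; _∷_; _++_; [_]; applyUpTo; reverse; length; map; concatMap; filter)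
open import Data.List.Properties
  using (∷-injective; ∷-injectiveˡ; ∷-injectiveʳ; ++-assoc; ++-cancelˡ; length-map; length-++;
         length-++-sucʳ; length-applyUpTo; unfold-reverse; filter-++; filter-all; filter-reject)
open import Data.List.Membership.Propositional using (_∈_; _∉_; find; lose)
open import Data.List.Membership.Propositional.Properties
  using (∈-++⁻; ∈-++⁺ˡ; ∈-++⁺ʳ; ∈-map⁻; ∈-map⁺; ∈-∃++; ∈-applyUpTo⁺; ∈-applyUpTo⁻; ∈-concatMap⁺; ∈-concatMap⁻)
open import Data.List.Relation.Unary.Any using (here; there)
open import Data.List.Relation.Unary.All as All using (All; []; _∷_)
open import Data.List.Relation.Unary.All.Properties using (¬Any⇒All¬; All¬⇒¬Any; ++⁻ˡ; ++⁻ʳ)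
open import Data.List.Relation.Unary.AllPairs as AllPairs using (AllPairs; []; _∷_)
import Data.List.Relation.Unary.AllPairs.Properties as AllPairsₚ
open import Data.List.Relation.Unary.Unique.Propositional using (Unique)
import Data.List.Relation.Unary.Unique.Propositional.Properties as Uniqueₚ
open import Data.List.Relation.Binary.Disjoint.Propositional using (Disjoint)
open import Data.Product using (Σ; ∃; ∃₂; _×_; _,_; proj₁; proj₂)
open import Data.Sum using (_⊎_; inj₁; inj₂)
open import Data.Empty using (⊥-elim)
open import Function using (_∘_)
open import Function.Bundles using (_⇔_; mk⇔)
open import Relation.Nullary using (Dec; yes; no; ¬?; _×-dec_; contradiction)
open import Relation.Binary.PropositionalEquality using (_≡_; _≢_; refl; sym; trans; cong; cong₂; subst; module ≡-Reasoning)
open import Relation.Binary.Construct.Closure.ReflexiveTransitive using (Star; ε; _◅_; _◅◅_; gmap)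

count-++ : ∀ x u v → count x (u ++ v) ≡ count x u + count x v
count-++ x []      v = refl
count-++ x (y ∷ u) v with x ≟ y
... | yes _ = cong suc (count-++ x u v)
... | no  _ = count-++ x u v

infix 4 _≈ₘ_

record _≈ₘ_ (u v : Word) : Set where
  field count-≡ : ∀ x → count x u ≡ count x v

open _≈ₘ_

≈ₘ-refl : ∀ {u} → u ≈ₘ u
≈ₘ-refl .count-≡ _ = refl

≈ₘ-sym : ∀ {u v} → u ≈ₘ v → v ≈ₘ u
≈ₘ-sym eq .count-≡ x = sym (eq .count-≡ x)

≈ₘ-trans : ∀ {u v w} → u ≈ₘ v → v ≈ₘ w → u ≈ₘ w
≈ₘ-trans eq eq′ .count-≡ x = trans (eq .count-≡ x) (eq′ .count-≡ x)

≈ₘ-∷ : ∀ y {u v} → u ≈ₘ v → y ∷ u ≈ₘ y ∷ v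
≈ₘ-∷ y eq .count-≡ x with x ≟ y
... | yes _ = cong suc (eq .count-≡ x)
... | no  _ = eq .count-≡ x

≈ₘ-∷⁻ : ∀ y {u v} → y ∷ u ≈ₘ y ∷ v → u ≈ₘ v
≈ₘ-∷⁻ y eq .count-≡ x with eq .count-≡ x
... | eqₓ with x ≟ y
...   | yes _ = suc-injective eqₓ
...   | no  _ = eqₓ

≈ₘ-++ˡ : ∀ z {u v} → u ≈ₘ v → z ++ u ≈ₘ z ++ v
≈ₘ-++ˡ []      eq = eq
≈ₘ-++ˡ (y ∷ z) eq = ≈ₘ-∷ y (≈ₘ-++ˡ z eq)

swap-≈ₘ : ∀ a b w → a ∷ b ∷ w ≈ₘ b ∷ a ∷ w
swap-≈ₘ a b w .count-≡ x = begin
  count x (a ∷ b ∷ w)                       ≡⟨ count-++ x [ a ] (b ∷ w) ⟩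
  count x [ a ] + count x (b ∷ w)           ≡⟨ cong (count x [ a ] +_) (count-++ x [ b ] w) ⟩
  count x [ a ] + (count x [ b ] + count x w) ≡⟨ x∙yz≈y∙xz (count x [ a ]) (count x [ b ]) (count x w) ⟩
  count x [ b ] + (count x [ a ] + count x w) ≡⟨ cong (count x [ b ] +_) (count-++ x [ a ] w) ⟨
  count x [ b ] + count x (a ∷ w)           ≡⟨ count-++ x [ b ] (a ∷ w) ⟨
  count x (b ∷ a ∷ w)                       ∎
  where open ≡-Reasoning

middle-≈ₘ : ∀ u x v → u ++ x ∷ v ≈ₘ x ∷ u ++ v
middle-≈ₘ []      x v = ≈ₘ-refl
middle-≈ₘ (y ∷ u) x v = ≈ₘ-trans (≈ₘ-∷ y (middle-≈ₘ u x v)) (swap-≈ₘ y x (u ++ v))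

∉⇒count≡0 : ∀ {x w} → x ∉ w → count x w ≡ 0
∉⇒count≡0 {x} {[]}    _   = refl
∉⇒count≡0 {x} {y ∷ w} x∉ with x ≟ y
... | yes x≡y = contradiction (here x≡y) x∉
... | no  _   = ∉⇒count≡0 (x∉ ∘ there)

∈⇒count≢0 : ∀ {x w} → x ∈ w → count x w ≢ 0
∈⇒count≢0 {x} {y ∷ w} x∈ with x ≟ y | x∈
... | yes _   | _         = λ ()
... | no  x≢y | here x≡y  = contradiction x≡y x≢y
... | no  _   | there x∈w = ∈⇒count≢0 x∈w

count≢0⇒∈ : ∀ {x} w → count x w ≢ 0 → x ∈ w
count≢0⇒∈ []      c≢0 = contradiction refl c≢0
count≢0⇒∈ {x} (y ∷ w) c≢0 with x ≟ y
... | yes x≡y = here x≡y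
... | no  _   = there (count≢0⇒∈ w c≢0)

∈-resp-≈ₘ : ∀ {x u v} → u ≈ₘ v → x ∈ u → x ∈ v
∈-resp-≈ₘ {v = v} eq x∈u = count≢0⇒∈ v (∈⇒count≢0 x∈u ∘ trans (eq .count-≡ _))

All-resp-≈ₘ : ∀ {P : ℕ → Set} {u v} → u ≈ₘ v → All P v → All P u
All-resp-≈ₘ eq pv = All.tabulate (All.lookup pv ∘ ∈-resp-≈ₘ eq)

Unique⇒count≡1 : ∀ {x w} → Unique w → x ∈ w → count x w ≡ 1
Unique⇒count≡1 {x} {y ∷ w} (y∉w ∷ uw) x∈ with x ≟ y | x∈
... | yes refl | _         = cong suc (∉⇒count≡0 (All¬⇒¬Any y∉w))
... | no  x≢y  | here x≡y  = contradiction x≡y x≢y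
... | no  _    | there x∈w = Unique⇒count≡1 uw x∈w

inserts : ℕ → Word → List Word
inserts x []       = [ x ∷ [] ]
inserts x (y ∷ ys) = (x ∷ y ∷ ys) ∷ map (y ∷_) (inserts x ys)

∈-inserts⁺ : ∀ x u v → u ++ x ∷ v ∈ inserts x (u ++ v)
∈-inserts⁺ x []      []      = here refl
∈-inserts⁺ x []      (y ∷ v) = here refl
∈-inserts⁺ x (y ∷ u) v       = there (∈-map⁺ (y ∷_) (∈-inserts⁺ x u v))

∈-inserts⁻ : ∀ {x σ} τ → σ ∈ inserts x τ → ∃₂ λ u v → τ ≡ u ++ v × σ ≡ u ++ x ∷ v
∈-inserts⁻ []       (here refl) = [] , [] , refl , refl
∈-inserts⁻ (y ∷ ys) (here refl) = [] , y ∷ ys , refl , refl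
∈-inserts⁻ (y ∷ ys) (there σ∈)
  with σ′ , σ′∈ , refl ← ∈-map⁻ (y ∷_) σ∈
  with u , v , refl , refl ← ∈-inserts⁻ ys σ′∈ = y ∷ u , v , refl , refl

length-inserts : ∀ x τ → length (inserts x τ) ≡ suc (length τ)
length-inserts x []       = refl
length-inserts x (y ∷ ys) = cong suc (trans (length-map (y ∷_) (inserts x ys)) (length-inserts x ys))

inserts-Unique : ∀ {x} τ → x ∉ τ → Unique (inserts x τ)
inserts-Unique []       _  = [] ∷ []
inserts-Unique {x} (y ∷ ys) x∉ =
  All.tabulate head-differs ∷ Uniqueₚ.map⁺ ∷-injectiveʳ (inserts-Unique ys (x∉ ∘ there))
  where
  head-differs : ∀ {σ} → σ ∈ map (y ∷_) (inserts x ys) → x ∷ y ∷ ys ≢ σ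
  head-differs σ∈ eq with _ , _ , refl ← ∈-map⁻ (y ∷_) σ∈ = x∉ (here (∷-injectiveˡ eq))

erase : ℕ → Word → Word
erase x = filter (λ y → ¬? (x ≟ y))

erase-inserts : ∀ {x σ} τ → x ∉ τ → σ ∈ inserts x τ → erase x σ ≡ τ
erase-inserts {x} τ x∉ σ∈ with u , v , refl , refl ← ∈-inserts⁻ τ σ∈ = begin
  erase x (u ++ x ∷ v)         ≡⟨ filter-++ keep u (x ∷ v) ⟩
  erase x u ++ erase x (x ∷ v) ≡⟨ cong (erase x u ++_) (filter-reject keep (λ x≢x → x≢x refl)) ⟩
  erase x u ++ erase x v       ≡⟨ cong (_++ erase x v) (filter-all keep (++⁻ˡ u x∉ᵤᵥ)) ⟩
  u ++ erase x v               ≡⟨ cong (u ++_) (filter-all keep (++⁻ʳ u x∉ᵤᵥ)) ⟩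
  u ++ v                       ∎
  where
  open ≡-Reasoning
  keep : ∀ y → Dec (x ≢ y)
  keep y = ¬? (x ≟ y)
  x∉ᵤᵥ : All (x ≢_) (u ++ v)
  x∉ᵤᵥ = ¬Any⇒All¬ (u ++ v) x∉

perms : Word → List Word
perms []       = [ [] ]
perms (x ∷ xs) = concatMap (inserts x) (perms xs)

∈-perms-∷⁻ : ∀ {σ} x xs → σ ∈ perms (x ∷ xs) → ∃ λ τ → τ ∈ perms xs × σ ∈ inserts x τ
∈-perms-∷⁻ x xs σ∈ = find (∈-concatMap⁻ (inserts x) σ∈)

∈-perms⇒≈ₘ : ∀ {σ} xs → σ ∈ perms xs → σ ≈ₘ xs
∈-perms⇒≈ₘ []       (here refl) = ≈ₘ-refl
∈-perms⇒≈ₘ (x ∷ xs) σ∈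
  with τ , τ∈ , σ∈ᵢ ← ∈-perms-∷⁻ x xs σ∈
  with u , v , refl , refl ← ∈-inserts⁻ τ σ∈ᵢ =
  ≈ₘ-trans (middle-≈ₘ u x v) (≈ₘ-∷ x (∈-perms⇒≈ₘ xs τ∈))

≈ₘ⇒∈-perms : ∀ {σ} xs → σ ≈ₘ xs → σ ∈ perms xs
≈ₘ⇒∈-perms {[]}    []       _  = here refl
≈ₘ⇒∈-perms {y ∷ σ} []       eq = contradiction (eq .count-≡ y) (∈⇒count≢0 {w = y ∷ σ} (here refl))
≈ₘ⇒∈-perms         (x ∷ xs) eq
  with u , v , refl ← ∈-∃++ (∈-resp-≈ₘ (≈ₘ-sym eq) (here refl)) =
  ∈-concatMap⁺ (inserts x) (lose τ∈ (∈-inserts⁺ x u v))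
  where
  τ∈ : u ++ v ∈ perms xs
  τ∈ = ≈ₘ⇒∈-perms xs (≈ₘ-∷⁻ x (≈ₘ-trans (≈ₘ-sym (middle-≈ₘ u x v)) eq))

length-concatMap-const : ∀ {A B : Set} (f : A → List B) k {xs} →
  (∀ {x} → x ∈ xs → length (f x) ≡ k) → length (concatMap f xs) ≡ length xs * k
length-concatMap-const f k {[]}     _   = refl
length-concatMap-const f k {x ∷ xs} len = begin
  length (f x ++ concatMap f xs)          ≡⟨ length-++ (f x) ⟩
  length (f x) + length (concatMap f xs)  ≡⟨ cong₂ _+_ (len (here refl)) (length-concatMap-const f k (len ∘ there)) ⟩
  k + length xs * k                       ∎
  where open ≡-Reasoning

concatMap-Unique : ∀ {A B : Set} (f : A → List B) (g : B → A) {xs} →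
  (∀ {x} → x ∈ xs → Unique (f x)) → (∀ {x y} → x ∈ xs → y ∈ f x → g y ≡ x) →
  Unique xs → Unique (concatMap f xs)
concatMap-Unique f g         _   _   []             = []
concatMap-Unique f g {x ∷ xs} uf inv (x∉xs ∷ uxs) =
  Uniqueₚ.++⁺ (uf (here refl)) (concatMap-Unique f g (uf ∘ there) (inv ∘ there) uxs) disjoint
  where
  disjoint : Disjoint (f x) (concatMap f xs)
  disjoint (y∈fx , y∈rest) with x′ , x′∈xs , y∈fx′ ← find (∈-concatMap⁻ f y∈rest) =
    All.lookup x∉xs x′∈xs (trans (sym (inv (here refl) y∈fx)) (inv (there x′∈xs) y∈fx′))

∈-perms⇒length : ∀ {σ} xs → σ ∈ perms xs → length σ ≡ length xs
∈-perms⇒length []       (here refl) = refl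
∈-perms⇒length (x ∷ xs) σ∈
  with τ , τ∈ , σ∈ᵢ ← ∈-perms-∷⁻ x xs σ∈
  with u , v , refl , refl ← ∈-inserts⁻ τ σ∈ᵢ =
  trans (length-++-sucʳ u x v) (cong suc (∈-perms⇒length xs τ∈))

length-perms : ∀ xs → length (perms xs) ≡ length xs !
length-perms []       = refl
length-perms (x ∷ xs) = begin
  length (concatMap (inserts x) (perms xs)) ≡⟨ length-concatMap-const (inserts x) (suc (length xs)) length-inserts-perm ⟩
  length (perms xs) * suc (length xs)       ≡⟨ cong (_* suc (length xs)) (length-perms xs) ⟩
  length xs ! * suc (length xs)             ≡⟨ *-comm (length xs !) (suc (length xs)) ⟩
  suc (length xs) !                         ∎
  where
  open ≡-Reasoning
  length-inserts-perm : ∀ {τ} → τ ∈ perms xs → length (inserts x τ) ≡ suc (length xs)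
  length-inserts-perm {τ} τ∈ = trans (length-inserts x τ) (cong suc (∈-perms⇒length xs τ∈))

perms-Unique : ∀ {xs} → Unique xs → Unique (perms xs)
perms-Unique {[]}     _             = [] ∷ []
perms-Unique {x ∷ xs} (x∉xs ∷ uxs) =
  concatMap-Unique (inserts x) (erase x)
    (λ τ∈ → inserts-Unique _ (x∉perm τ∈)) (λ τ∈ → erase-inserts _ (x∉perm τ∈)) (perms-Unique uxs)
  where
  x∉perm : ∀ {τ} → τ ∈ perms xs → x ∉ τ
  x∉perm τ∈ x∈τ = All.lookup x∉xs (∈-resp-≈ₘ (∈-perms⇒≈ₘ xs τ∈) x∈τ) refl

Swap* : Word → Word → Set
Swap* = Star Swap

Swap⇒≈ₘ : ∀ {s t} → Swap s t → s ≈ₘ t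
Swap⇒≈ₘ (u , v , a , b , _ , refl , refl) = ≈ₘ-++ˡ u (swap-≈ₘ a b v)

Swap-++ˡ : ∀ z {s t} → Swap s t → Swap (z ++ s) (z ++ t)
Swap-++ˡ z (u , v , a , b , a<b , refl , refl) =
  z ++ u , v , a , b , a<b , sym (++-assoc z u _) , sym (++-assoc z u _)

Swap-++ʳ : ∀ z {s t} → Swap s t → Swap (s ++ z) (t ++ z)
Swap-++ʳ z (u , v , a , b , a<b , refl , refl) =
  u , v ++ z , a , b , a<b , ++-assoc u _ z , ++-assoc u _ z

Swap*-++ˡ : ∀ z {s t} → Swap* s t → Swap* (z ++ s) (z ++ t)
Swap*-++ˡ z = gmap (z ++_) (Swap-++ˡ z)

Swap*-++ʳ : ∀ z {s t} → Swap* s t → Swap* (s ++ z) (t ++ z)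
Swap*-++ʳ z = gmap (_++ z) (Swap-++ʳ z)

bubble : ∀ {x} v → All (x <_) v → Swap* (x ∷ v) (v ++ [ x ])
bubble []      []           = ε
bubble (y ∷ v) (x<y ∷ x<v) = ([] , v , _ , y , x<y , refl , refl) ◅ Swap*-++ˡ [ y ] (bubble v x<v)

Swap*-∷-inserts : ∀ {x σ} τ → All (x <_) τ → σ ∈ inserts x τ → Swap* (x ∷ τ) σ
Swap*-∷-inserts {x} τ x<τ σ∈ with u , v , refl , refl ← ∈-inserts⁻ τ σ∈ =
  subst (Swap* (x ∷ u ++ v)) (++-assoc u [ x ] v) (Swap*-++ʳ v (bubble u (++⁻ˡ u x<τ)))

Swap*-inserts-∷ʳ : ∀ {x σ} τ → All (x <_) τ → σ ∈ inserts x τ → Swap* σ (τ ++ [ x ])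
Swap*-inserts-∷ʳ {x} τ x<τ σ∈ with u , v , refl , refl ← ∈-inserts⁻ τ σ∈ =
  subst (Swap* (u ++ x ∷ v)) (sym (++-assoc u v [ x ])) (Swap*-++ˡ u (bubble v (++⁻ʳ u x<τ)))

sorted-Swap*-perm : ∀ {σ} xs → AllPairs _<_ xs → σ ∈ perms xs → Swap* xs σ
sorted-Swap*-perm []       _              (here refl) = ε
sorted-Swap*-perm (x ∷ xs) (x<xs ∷ sorted) σ∈ with τ , τ∈ , σ∈ᵢ ← ∈-perms-∷⁻ x xs σ∈ =
  Swap*-++ˡ [ x ] (sorted-Swap*-perm xs sorted τ∈)
  ◅◅ Swap*-∷-inserts τ (All-resp-≈ₘ (∈-perms⇒≈ₘ xs τ∈) x<xs) σ∈ᵢ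

perm-Swap*-reverse : ∀ {σ} xs → AllPairs _<_ xs → σ ∈ perms xs → Swap* σ (reverse xs)
perm-Swap*-reverse []       _              (here refl) = ε
perm-Swap*-reverse (x ∷ xs) (x<xs ∷ sorted) σ∈ with τ , τ∈ , σ∈ᵢ ← ∈-perms-∷⁻ x xs σ∈ =
  Swap*-inserts-∷ʳ τ (All-resp-≈ₘ (∈-perms⇒≈ₘ xs τ∈) x<xs) σ∈ᵢ
  ◅◅ subst (Swap* (τ ++ [ x ])) (sym (unfold-reverse x xs)) (Swap*-++ʳ [ x ] (perm-Swap*-reverse xs sorted τ∈))

∈-incr⁺ : ∀ {x n} → 1 ≤ x → x ≤ n → x ∈ incr n
∈-incr⁺ {suc i} (s≤s _) i<n = ∈-applyUpTo⁺ suc i<n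

∈-incr⁻ : ∀ {x n} → x ∈ incr n → 1 ≤ x × x ≤ n
∈-incr⁻ x∈ with _ , i<n , refl ← ∈-applyUpTo⁻ suc x∈ = s≤s z≤n , i<n

incr-sorted : ∀ n → AllPairs _<_ (incr n)
incr-sorted n = AllPairsₚ.applyUpTo⁺₁ suc n (λ i<j _ → s≤s i<j)

incr-Unique : ∀ n → Unique (incr n)
incr-Unique n = AllPairs.map <⇒≢ (incr-sorted n)

count-incr : ∀ {x n} → 1 ≤ x → x ≤ n → count x (incr n) ≡ 1
count-incr {n = n} 1≤x x≤n = Unique⇒count≡1 (incr-Unique n) (∈-incr⁺ 1≤x x≤n)

applyUpTo-≡-++-∷ : ∀ (f : ℕ → ℕ) n {u x w} → applyUpTo f n ≡ u ++ x ∷ w →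
  x ≡ f (length u) × u ≡ applyUpTo f (length u)
applyUpTo-≡-++-∷ f zero    {[]}    ()
applyUpTo-≡-++-∷ f zero    {_ ∷ _} ()
applyUpTo-≡-++-∷ f (suc n) {[]}    eq = sym (∷-injectiveˡ eq) , refl
applyUpTo-≡-++-∷ f (suc n) {y ∷ u} eq with refl , eq′ ← ∷-injective eq
  with x≡ , u≡ ← applyUpTo-≡-++-∷ (f ∘ suc) n eq′ = x≡ , cong (f 0 ∷_) u≡

++-≡-++-∷ : ∀ {A : Set} (xs : List A) {p u c v} → xs ++ p ≡ u ++ c ∷ v →
  (∃ λ u′ → u ≡ xs ++ u′) ⊎ (∃ λ u₂ → xs ≡ u ++ c ∷ u₂)
++-≡-++-∷ []       {u = u}     _  = inj₁ (u , refl)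
++-≡-++-∷ (x ∷ xs) {u = []}    eq with refl , _ ← ∷-injective eq = inj₂ (xs , refl)
++-≡-++-∷ (x ∷ xs) {u = y ∷ u} eq with refl , eq′ ← ∷-injective eq with ++-≡-++-∷ xs eq′
... | inj₁ (u′ , refl) = inj₁ (u′ , refl)
... | inj₂ (u₂ , refl) = inj₂ (u₂ , refl)

≈ₘ-incr⇒IsBL : ∀ n {p} → p ≈ₘ incr n → IsBL n (incr n ++ p)
≈ₘ-incr⇒IsBL n {p} p≈ = letters , counts , first-occurrences
  where
  letters : ∀ x → x ∈ incr n ++ p → 1 ≤ x × x ≤ n
  letters x x∈ with ∈-++⁻ (incr n) x∈
  ... | inj₁ x∈incr = ∈-incr⁻ x∈incr
  ... | inj₂ x∈p    = ∈-incr⁻ (∈-resp-≈ₘ p≈ x∈p)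
  counts : ∀ i → 1 ≤ i → i ≤ n → count i (incr n ++ p) ≡ 2
  counts i 1≤i i≤n = trans (count-++ i (incr n) p)
    (cong₂ _+_ (count-incr 1≤i i≤n) (trans (p≈ .count-≡ i) (count-incr 1≤i i≤n)))
  first-occurrences : ∀ i → 1 ≤ i → i < n → ∀ u v → incr n ++ p ≡ u ++ suc i ∷ v → i ∈ u
  first-occurrences i 1≤i i<n u v eq with ++-≡-++-∷ (incr n) eq
  ... | inj₁ (u′ , refl) = ∈-++⁺ˡ (∈-incr⁺ 1≤i (<⇒≤ i<n))
  ... | inj₂ (_ , eq′) with 1+i≡ , u≡ ← applyUpTo-≡-++-∷ suc n eq′ =
    subst (i ∈_) (sym u≡) (∈-incr⁺ 1≤i (≤-reflexive (suc-injective 1+i≡)))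

IsBL⇒≈ₘ-incr : ∀ n {p} → IsBL n (incr n ++ p) → p ≈ₘ incr n
IsBL⇒≈ₘ-incr n {p} (letters , counts , _) .count-≡ x with 1 ≤? x ×-dec x ≤? n
... | yes (1≤x , x≤n) = trans (suc-injective 1+c≡2) (sym (count-incr 1≤x x≤n))
  where
  1+c≡2 : 1 + count x p ≡ 2
  1+c≡2 = begin
    1 + count x p                  ≡⟨ cong (_+ count x p) (count-incr 1≤x x≤n) ⟨
    count x (incr n) + count x p   ≡⟨ count-++ x (incr n) p ⟨
    count x (incr n ++ p)          ≡⟨ counts x 1≤x x≤n ⟩
    2                              ∎
    where open ≡-Reasoning
... | no out = trans (∉⇒count≡0 (out ∘ letters x ∘ ∈-++⁺ʳ (incr n))) (sym (∉⇒count≡0 (out ∘ ∈-incr⁻)))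

length-∷ʳ : ∀ (u : Word) a → length (u ++ [ a ]) ≡ suc (length u)
length-∷ʳ u a = trans (length-++ u) (+-comm (length u) 1)

incr-last : ∀ n {u a} → incr n ≡ u ++ [ a ] → a ≡ n
incr-last n {u} {a} eq = begin
  a                     ≡⟨ proj₁ (applyUpTo-≡-++-∷ suc n eq) ⟩
  suc (length u)        ≡⟨ length-∷ʳ u a ⟨
  length (u ++ [ a ])   ≡⟨ cong length eq ⟨
  length (incr n)       ≡⟨ length-applyUpTo suc n ⟩
  n                     ∎
  where open ≡-Reasoning

incr-successor : ∀ n {u a c w} → incr n ≡ u ++ a ∷ c ∷ w → c ≡ suc a
incr-successor n {u} {a} {c} {w} eq = begin
  c                          ≡⟨ proj₁ (applyUpTo-≡-++-∷ suc n (trans eq (sym (++-assoc u [ a ] (c ∷ w))))) ⟩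
  suc (length (u ++ [ a ]))  ≡⟨ cong suc (length-∷ʳ u a) ⟩
  suc (suc (length u))       ≡⟨ cong suc (proj₁ (applyUpTo-≡-++-∷ suc n eq)) ⟨
  suc a                      ∎
  where open ≡-Reasoning

incr-first-occurrence : ∀ n {u a w} → incr n ≡ u ++ a ∷ w → a ∉ u
incr-first-occurrence n {u} eq a∈u with a≡ , u≡ ← applyUpTo-≡-++-∷ suc n eq =
  ≤⇒≯ (proj₂ (∈-incr⁻ (subst (_ ∈_) u≡ a∈u))) (≤-reflexive (sym a≡))

Cover-incr-prefix : ∀ n {p t} → Cover n (incr n ++ p) t → ∃ λ q → t ≡ incr n ++ q
Cover-incr-prefix n {p} {t} ((letters-s , _) , (_ , _ , first-t) , u , v , a , b , a<b , es , et) =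
  prefix-or-inside (++-≡-++-∷ (incr n) es)
  where
  a<n : a < n
  a<n = <-≤-trans a<b (proj₂ (letters-s b (subst (b ∈_) (sym es) (∈-++⁺ʳ u (there (here refl))))))

  prefix-or-inside : (∃ λ u′ → u ≡ incr n ++ u′) ⊎ (∃ λ u₂ → incr n ≡ u ++ a ∷ u₂) → ∃ λ q → t ≡ incr n ++ q
  prefix-or-inside (inj₁ (u′ , u≡)) = u′ ++ b ∷ a ∷ v , (begin
    t                         ≡⟨ et ⟩
    u ++ b ∷ a ∷ v            ≡⟨ cong (_++ b ∷ a ∷ v) u≡ ⟩
    (incr n ++ u′) ++ b ∷ a ∷ v ≡⟨ ++-assoc (incr n) u′ _ ⟩
    incr n ++ u′ ++ b ∷ a ∷ v ∎)
    where open ≡-Reasoning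
  prefix-or-inside (inj₂ ([] , eq))    = contradiction (incr-last n eq) (<⇒≢ a<n)
  prefix-or-inside (inj₂ (c ∷ w , eq)) = ⊥-elim (incr-first-occurrence n eq (first-t a 1≤a a<n u (a ∷ v) t≡))
    where
    open ≡-Reasoning
    b≡c : b ≡ c
    b≡c = ∷-injectiveˡ (∷-injectiveʳ (++-cancelˡ u _ _ (begin
      u ++ a ∷ b ∷ v              ≡⟨ es ⟨
      incr n ++ p                 ≡⟨ cong (_++ p) eq ⟩
      (u ++ a ∷ c ∷ w) ++ p       ≡⟨ ++-assoc u _ p ⟩
      u ++ a ∷ c ∷ w ++ p         ∎)))
    t≡ : t ≡ u ++ suc a ∷ a ∷ v
    t≡ = trans et (cong (λ x → u ++ x ∷ a ∷ v) (trans b≡c (incr-successor n eq)))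
    1≤a : 1 ≤ a
    1≤a = proj₁ (∈-incr⁻ (subst (a ∈_) (sym eq) (∈-++⁺ʳ u (here refl))))

≤BL-incr-prefix : ∀ n {p t} → (incr n ++ p) ≤BL[ n ] t → ∃ λ q → t ≡ incr n ++ q
≤BL-incr-prefix n {p} ε = p , refl
≤BL-incr-prefix n (c ◅ rest) with q , refl ← Cover-incr-prefix n c = ≤BL-incr-prefix n rest

Swap*⇒≤BL : ∀ n {p q} → p ≈ₘ incr n → Swap* p q → (incr n ++ p) ≤BL[ n ] (incr n ++ q)
Swap*⇒≤BL n p≈ ε                = ε
Swap*⇒≤BL n p≈ (_◅_ {j = r} sw rest) =
  (≈ₘ-incr⇒IsBL n p≈ , ≈ₘ-incr⇒IsBL n r≈ , Swap-++ˡ (incr n) sw) ◅ Swap*⇒≤BL n r≈ rest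
  where
  r≈ : r ≈ₘ incr n
  r≈ = ≈ₘ-trans (≈ₘ-sym (Swap⇒≈ₘ sw)) p≈

intervalWords : ℕ → List Word
intervalWords n = map (incr n ++_) (perms (incr n))

corollary6p2 : (n : ℕ) → 1 ≤ n →
    Σ (List Word) λ L → Unique L × length L ≡ n ! ×
      ((w : Word) → (w ∈ L ⇔ InInterval n (bottomWord n) (topWord n) w))
corollary6p2 n _ = intervalWords n , unique , size , λ w → mk⇔ (to w) (from w)
  where
  unique : Unique (intervalWords n)
  unique = Uniqueₚ.map⁺ (++-cancelˡ (incr n) _ _) (perms-Unique (incr-Unique n))

  size : length (intervalWords n) ≡ n !
  size = trans (length-map _ (perms (incr n))) (trans (length-perms (incr n)) (cong _! (length-applyUpTo suc n)))

  to : ∀ w → w ∈ intervalWords n → InInterval n (bottomWord n) (topWord n) w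
  to w w∈ with σ , σ∈ , refl ← ∈-map⁻ (incr n ++_) w∈ =
    ≈ₘ-incr⇒IsBL n σ≈ ,
    Swap*⇒≤BL n ≈ₘ-refl (sorted-Swap*-perm (incr n) (incr-sorted n) σ∈) ,
    Swap*⇒≤BL n σ≈ (perm-Swap*-reverse (incr n) (incr-sorted n) σ∈)
    where
    σ≈ : σ ≈ₘ incr n
    σ≈ = ∈-perms⇒≈ₘ (incr n) σ∈

  from : ∀ w → InInterval n (bottomWord n) (topWord n) w → w ∈ intervalWords n
  from w (bl , bottom≤w , _) with p , refl ← ≤BL-incr-prefix n bottom≤w =
    ∈-map⁺ (incr n ++_) (≈ₘ⇒∈-perms (incr n) (IsBL⇒≈ₘ-incr n bl))
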